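{- Let $(U,\varphi)$ be a finite standard closure space and $x\in U$. For every $C\in\{\varphi(B): B \text{ an } E\text{ -generator of } x\}$ there exist a pseudo-closed set $P$ (so that $P\to C\setminus P$ belongs to the canonical base) and an $E$-generator $A$ of $x$ such that $A\subseteq P$, $x\notin P$, and $\varphi(A)=\varphi(P)=C$.
   Context: $(U,\varphi)$: finite set with closure operator; standard: $\varphi(\{x\})\setminus\{x\}$ closed for all $x$. Quasi-closed $Q$: for all $X\subseteq Q$ with $\varphi(X)\subsetneq\varphi(Q)$, $\varphi(X)\subseteq Q$. Pseudo-closed $P$: not closed and inclusion-minimal among quasi-closed $Q$ with $\varphi(Q)=\varphi(P)$. Canonical (Duquenne–Guigues) base: $\{P\to\varphi(P)\setminus P: P \text{ pseudo-closed}\}$. $\varphi^b(X)=\bigcup_{y\in X}\varphi(\{y\})$. $D$-generator of $x$: $A$ with $x\in\varphi(A)$, $x\notin\varphi^b(A)$, and $x\notin\varphi(B)$ whenever $\varphi^b(B)\subsetneq\varphi^b(A)$. $E$-generator of $x$: a $D$-generator $A$ with $\varphi(A)$ inclusion-minimal among closures of $D$-generators of $x$. -}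

module Defs where

open import Data.Nat using (ℕ)
open import Data.Fin using (Fin)
open import Data.Fin.Subset
open import Data.Bool using (if_then_else_)
open import Data.Vec using (lookup)
open import Data.List using (List; map; allFin)
open import Data.Product using (_×_; Σ; ∃-syntax)
open import Relation.Nullary using (¬_)
open import Relation.Binary.PropositionalEquality using (_≡_)

record ClosureOperator (n : ℕ) : Set where
  field
    φ          : Subset n → Subset n
    extensive  : ∀ X → X ⊆ φ X
    monotone   : ∀ {X Y} → X ⊆ Y → φ X ⊆ φ Y
    idempotent : ∀ X → φ (φ X) ≡ φ X

module _ {n : ℕ} (cs : ClosureOperator n) where
  open ClosureOperator cs

  Closed : Subset n → Set
  Closed X = φ X ≡ X

  Standard : Set
  Standard = ∀ (x : Fin n) → Closed (φ ⁅ x ⁆ - x)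

  QuasiClosed : Subset n → Set
  QuasiClosed Q = ∀ X → X ⊆ Q → φ X ⊂ φ Q → φ X ⊆ Q

  PseudoClosed : Subset n → Set
  PseudoClosed P =
    ¬ Closed P × QuasiClosed P ×
    (∀ Q → QuasiClosed Q → φ Q ≡ φ P → Q ⊆ P → P ⊆ Q)

  φb : Subset n → Subset n
  φb X = ⋃ (map (λ y → if lookup X y then φ ⁅ y ⁆ else ⊥) (allFin n))

  DGenerator : Fin n → Subset n → Set
  DGenerator x A =
    x ∈ φ A × x ∉ φb A × (∀ B → φb B ⊂ φb A → x ∉ φ B)

  EGenerator : Fin n → Subset n → Set
  EGenerator x A =
    DGenerator x A × (∀ A′ → DGenerator x A′ → φ A′ ⊆ φ A → φ A ⊆ φ A′)

{-# OPTIONS --safe #-}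
-- Let B be an E-generator of x, C = φ B, and Q = C ∩ {y | x ∉ φ {y}}.  Q contains B, so
-- φ Q = C, and Q is quasi-closed: if X ⊆ Q and some z ∈ φ X had x ∈ φ {z}, then x ∈ φ X
-- but x ∉ φᵇ X, so X lies above a D-generator of x, and E-minimality of C forces φ X = C.
-- A ⊂-minimal quasi-closed P ⊆ Q with φ P = C is pseudo-closed, being not closed as x ∉ P.
-- Quasi-closedness of P gives φᵇ P ⊆ P because x ∉ φ {y} for y ∈ P, so a D-generator A
-- with φᵇ A ⊆ φᵇ P lies inside P, and E-minimality of C makes A an E-generator with φ A = C.
module Submission where

open import Defs
open import Data.Nat using (ℕ)
open import Data.Fin using (Fin)
open import Data.Fin.Subset using (Subset; _⊆_; _∉_)
open import Data.Product using (_×_; ∃-syntax)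
open import Relation.Binary.PropositionalEquality using (_≡_)

open import Data.Bool using (true; false; if_then_else_) renaming (_≟_ to _≟ᵇ_)
open import Data.Fin.Subset using (_∈_; _⊂_; _∩_; ⁅_⁆; ⊥; ⋃)
open import Data.Fin.Subset.Induction using (⊂-wellFounded)
open import Data.Fin.Subset.Properties
open import Data.List using (List; []; _∷_; map; allFin)
open import Data.List.Membership.Propositional using (lose)
open import Data.List.Membership.Propositional.Properties using (∈-allFin)
open import Data.List.Relation.Unary.Any using (Any; here; there; satisfied)
import Data.List.Relation.Unary.Any.Properties as Any
open import Data.Product using (_,_)
open import Data.Sum using (inj₁; inj₂; [_,_]′)
open import Data.Vec using (lookup; tabulate)
open import Data.Vec.Properties using ([]=⇒lookup; lookup⇒[]=; lookup∘tabulate; ≡-dec)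
open import Function using (_∘_; id)
open import Induction.WellFounded using (Acc; acc)
open import Level using (Level)
open import Relation.Binary.PropositionalEquality using (refl; sym; trans; subst)
open import Relation.Nullary using (¬_; Dec; yes; no; does; contradiction)
open import Relation.Nullary.Decidable using (_×-dec_; _→-dec_; ¬?; dec-true; decidable-stable)
open import Relation.Unary using (Pred; Decidable)

private
  variable
    ℓ : Level
    n : ℕ
    x y z : Fin n
    A B X Y : Subset n

∈-⋃⁺ : {ps : List (Subset n)} → Any (x ∈_) ps → x ∈ ⋃ ps
∈-⋃⁺ (here x∈p)   = x∈p∪q⁺ (inj₁ x∈p)
∈-⋃⁺ (there x∈ps) = x∈p∪q⁺ (inj₂ (∈-⋃⁺ x∈ps))

∈-⋃⁻ : (ps : List (Subset n)) → x ∈ ⋃ ps → Any (x ∈_) ps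
∈-⋃⁻ []       x∈⊥ = contradiction x∈⊥ ∉⊥
∈-⋃⁻ (p ∷ ps) x∈  = [ here , there ∘ ∈-⋃⁻ ps ]′ (x∈p∪q⁻ p (⋃ ps) x∈)

x∈p⇒⁅x⁆⊆p : x ∈ X → ⁅ x ⁆ ⊆ X
x∈p⇒⁅x⁆⊆p x∈X y∈⁅x⁆ with refl ← x∈⁅y⁆⇒x≡y _ y∈⁅x⁆ = x∈X

module _ {P : Pred (Fin n) ℓ} (P? : Decidable P) where

  select : Subset n
  select = tabulate (does ∘ P?)

  ∈-select⁺ : P x → x ∈ select
  ∈-select⁺ {x} px = lookup⇒[]= x select (trans (lookup∘tabulate _ x) (dec-true (P? x) px))

  ∈-select⁻ : x ∈ select → P x
  ∈-select⁻ {x} x∈ =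
    does⇒ (P? x) (trans (sym (lookup∘tabulate _ x)) ([]=⇒lookup x∈))
    where
    does⇒ : (px? : Dec (P x)) → does px? ≡ true → P x
    does⇒ (yes px) _ = px

module _ {R : Pred (Subset n) ℓ} (R? : Decidable R) where

  allSubsets? : Dec (∀ X → R X)
  allSubsets? with anySubset? (¬? ∘ R?)
  ... | yes (X , ¬RX) = no λ ∀R → ¬RX (∀R X)
  ... | no ∄¬R        = yes λ X → decidable-stable (R? X) (λ ¬RX → ∄¬R (X , ¬RX))

  ⊂-minimal-on : (f : Subset n → Subset n) → R X →
                 ∃[ M ] (R M × ∀ {X′} → R X′ → ¬ f X′ ⊂ f M)
  ⊂-minimal-on f = descend (⊂-wellFounded _)
    where
    descend : ∀ {X} → Acc _⊂_ (f X) → R X → ∃[ M ] (R M × ∀ {X′} → R X′ → ¬ f X′ ⊂ f M)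
    descend {X} (acc smaller) RX with anySubset? (λ X′ → R? X′ ×-dec f X′ ⊂? f X)
    ... | yes (X′ , RX′ , fX′⊂fX) = descend (smaller fX′⊂fX) RX′
    ... | no ∄smaller             = X , RX , λ RX′ fX′⊂fX → ∄smaller (_ , RX′ , fX′⊂fX)

module _ (cs : ClosureOperator n) where
  open ClosureOperator cs

  ⊆φ⇒φ⊆φ : X ⊆ φ Y → φ X ⊆ φ Y
  ⊆φ⇒φ⊆φ {Y = Y} X⊆φY z∈φX = subst (_ ∈_) (idempotent Y) (monotone X⊆φY z∈φX)

  private
    summand : Subset n → Fin n → Subset n
    summand X y = if lookup X y then φ ⁅ y ⁆ else ⊥

    ∈-summand⁺ : y ∈ X → z ∈ φ ⁅ y ⁆ → z ∈ summand X y
    ∈-summand⁺ y∈X z∈φy rewrite []=⇒lookup y∈X = z∈φy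

    ∈-summand⁻ : z ∈ summand X y → y ∈ X × z ∈ φ ⁅ y ⁆
    ∈-summand⁻ {X = X} {y} z∈ with lookup X y in eq
    ... | true  = lookup⇒[]= y X eq , z∈
    ... | false = contradiction z∈ ∉⊥

  ∈-φb⁺ : y ∈ X → z ∈ φ ⁅ y ⁆ → z ∈ φb cs X
  ∈-φb⁺ {y} y∈X z∈φy = ∈-⋃⁺ (Any.map⁺ (lose (∈-allFin y) (∈-summand⁺ y∈X z∈φy)))

  ∈-φb⁻ : z ∈ φb cs X → ∃[ y ] (y ∈ X × z ∈ φ ⁅ y ⁆)
  ∈-φb⁻ {X = X} z∈
    with y , z∈summand ← satisfied (Any.map⁻ (∈-⋃⁻ (map (summand X) (allFin n)) z∈)) =
    y , ∈-summand⁻ z∈summand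

  ⊆-φb : X ⊆ φb cs X
  ⊆-φb y∈X = ∈-φb⁺ y∈X (extensive _ (x∈⁅x⁆ _))

  φb⊆φ : φb cs X ⊆ φ X
  φb⊆φ z∈ with y , y∈X , z∈φy ← ∈-φb⁻ z∈ = monotone (x∈p⇒⁅x⁆⊆p y∈X) z∈φy

  φb⊆φb⇒φ⊆φ : φb cs X ⊆ φb cs Y → φ X ⊆ φ Y
  φb⊆φb⇒φ⊆φ φbX⊆φbY = ⊆φ⇒φ⊆φ (φb⊆φ ∘ φbX⊆φbY ∘ ⊆-φb)

  quasiClosed? : Decidable (QuasiClosed cs)
  quasiClosed? Q = allSubsets? λ X → X ⊆? Q →-dec φ X ⊂? φ Q →-dec φ X ⊆? Q

  pseudoClosed-below : ∀ {Q} → QuasiClosed cs Q → ¬ Closed cs Q →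
                       ∃[ P ] (PseudoClosed cs P × P ⊆ Q × φ P ≡ φ Q)
  pseudoClosed-below {Q} qQ ¬closedQ =
    pseudoClosed (⊂-minimal-on candidate? id (qQ , refl , ⊆-refl))
    where
    Candidate : Subset n → Set
    Candidate P = QuasiClosed cs P × φ P ≡ φ Q × P ⊆ Q

    candidate? : Decidable Candidate
    candidate? P = quasiClosed? P ×-dec ≡-dec _≟ᵇ_ (φ P) (φ Q) ×-dec P ⊆? Q

    pseudoClosed : ∃[ P ] (Candidate P × ∀ {P′} → Candidate P′ → ¬ P′ ⊂ P) →
                   ∃[ P ] (PseudoClosed cs P × P ⊆ Q × φ P ≡ φ Q)
    pseudoClosed (P , (qP , φP≡φQ , P⊆Q) , minimal) =
      P , (¬closedP , qP , minimalP) , P⊆Q , φP≡φQ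
      where
      ¬closedP : ¬ Closed cs P
      ¬closedP φP≡P =
        ¬closedQ (⊆-antisym (subst (_⊆ Q) (trans (sym φP≡P) φP≡φQ) P⊆Q) (extensive Q))

      minimalP : ∀ P′ → QuasiClosed cs P′ → φ P′ ≡ φ P → P′ ⊆ P → P ⊆ P′
      minimalP P′ qP′ φP′≡φP P′⊆P {y} y∈P = decidable-stable (y ∈? P′) λ y∉P′ →
        minimal (qP′ , trans φP′≡φP φP≡φQ , P⊆Q ∘ P′⊆P) (P′⊆P , y , y∈P , y∉P′)

  Avoiding : Fin n → Subset n
  Avoiding x = select λ y → ¬? (x ∈? φ ⁅ y ⁆)

  ∈-Avoiding⁺ : x ∉ φ ⁅ y ⁆ → y ∈ Avoiding x
  ∈-Avoiding⁺ {x} = ∈-select⁺ (λ y → ¬? (x ∈? φ ⁅ y ⁆))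

  ∈-Avoiding⁻ : y ∈ Avoiding x → x ∉ φ ⁅ y ⁆
  ∈-Avoiding⁻ {x = x} = ∈-select⁻ (λ y → ¬? (x ∈? φ ⁅ y ⁆))

  x∉Avoiding : x ∉ Avoiding x
  x∉Avoiding x∈ = ∈-Avoiding⁻ x∈ (extensive _ (x∈⁅x⁆ _))

  ⊆Avoiding⇒∉φb : Y ⊆ Avoiding x → x ∉ φb cs Y
  ⊆Avoiding⇒∉φb Y⊆ x∈ with y , y∈Y , x∈φy ← ∈-φb⁻ x∈ = ∈-Avoiding⁻ (Y⊆ y∈Y) x∈φy

  ∉φb⇒⊆Avoiding : x ∉ φb cs Y → Y ⊆ Avoiding x
  ∉φb⇒⊆Avoiding x∉ y∈Y = ∈-Avoiding⁺ (x∉ ∘ ∈-φb⁺ y∈Y)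

  φb⊆-quasiClosed : ∀ {Q} → QuasiClosed cs Q → x ∈ φ Q → Q ⊆ Avoiding x → φb cs Q ⊆ Q
  φb⊆-quasiClosed qQ x∈φQ Q⊆ z∈ with y , y∈Q , z∈φy ← ∈-φb⁻ z∈ =
    qQ ⁅ y ⁆ (x∈p⇒⁅x⁆⊆p y∈Q) (monotone (x∈p⇒⁅x⁆⊆p y∈Q) , _ , x∈φQ , ∈-Avoiding⁻ (Q⊆ y∈Q)) z∈φy

  DGenerator-below : x ∈ φ Y → x ∉ φb cs Y → ∃[ A ] (DGenerator cs x A × φb cs A ⊆ φb cs Y)
  DGenerator-below {x} {Y} x∈φY x∉φbY =
    dGenerator (⊂-minimal-on generating? (φb cs) (x∈φY , x∉φbY , ⊆-refl))
    where
    Generating : Subset n → Set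
    Generating A = x ∈ φ A × x ∉ φb cs A × φb cs A ⊆ φb cs Y

    generating? : Decidable Generating
    generating? A = x ∈? φ A ×-dec ¬? (x ∈? φb cs A) ×-dec φb cs A ⊆? φb cs Y

    dGenerator : ∃[ A ] (Generating A × ∀ {A′} → Generating A′ → ¬ φb cs A′ ⊂ φb cs A) →
                 ∃[ A ] (DGenerator cs x A × φb cs A ⊆ φb cs Y)
    dGenerator (A , (x∈φA , x∉φbA , φbA⊆φbY) , minimal) =
      A , (x∈φA , x∉φbA , ∉φ-below) , φbA⊆φbY
      where
      ∉φ-below : ∀ B → φb cs B ⊂ φb cs A → x ∉ φ B
      ∉φ-below B φbB⊂φbA x∈φB =
        minimal (x∈φB , x∉φbA ∘ p⊂q⇒p⊆q φbB⊂φbA , φbA⊆φbY ∘ p⊂q⇒p⊆q φbB⊂φbA) φbB⊂φbA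

  EGenerator-closure-least : EGenerator cs x B → x ∈ φ Y → x ∉ φb cs Y → φ Y ⊆ φ B → φ B ⊆ φ Y
  EGenerator-closure-least (_ , least) x∈φY x∉φbY φY⊆φB
    with A , DA , φbA⊆φbY ← DGenerator-below x∈φY x∉φbY =
    φb⊆φb⇒φ⊆φ φbA⊆φbY ∘ least A DA (φY⊆φB ∘ φb⊆φb⇒φ⊆φ φbA⊆φbY)

  EGenerator-sameClosure : EGenerator cs x B → DGenerator cs x A → φ A ⊆ φ B →
                           EGenerator cs x A × φ A ≡ φ B
  EGenerator-sameClosure (_ , least) DA φA⊆φB =
    (DA , λ A′ DA′ φA′⊆φA → least A′ DA′ (φA⊆φB ∘ φA′⊆φA) ∘ φA⊆φB) ,
    ⊆-antisym φA⊆φB (least _ DA φA⊆φB)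

  φ-∩Avoiding : x ∉ φb cs B → φ (φ B ∩ Avoiding x) ≡ φ B
  φ-∩Avoiding {B = B} x∉φbB =
    ⊆-antisym (⊆φ⇒φ⊆φ (p∩q⊆p _ _))
              (monotone λ y∈B → x∈p∩q⁺ (extensive B y∈B , ∉φb⇒⊆Avoiding x∉φbB y∈B))

  ¬closed-∩Avoiding : x ∈ φ B → x ∉ φb cs B → ¬ Closed cs (φ B ∩ Avoiding x)
  ¬closed-∩Avoiding x∈φB x∉φbB closed =
    x∉Avoiding (p∩q⊆q _ _ (subst (_ ∈_) closed (subst (_ ∈_) (sym (φ-∩Avoiding x∉φbB)) x∈φB)))

  quasiClosed-∩Avoiding : EGenerator cs x B → QuasiClosed cs (φ B ∩ Avoiding x)
  quasiClosed-∩Avoiding {x} {B} EB X X⊆Q (φX⊆φQ , w , w∈φQ , w∉φX) {z} z∈φX =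
    x∈p∩q⁺ (φQ⊆φB (φX⊆φQ z∈φX) , ∈-Avoiding⁺ x∉φz)
    where
    φQ⊆φB : φ (φ B ∩ Avoiding x) ⊆ φ B
    φQ⊆φB = ⊆φ⇒φ⊆φ (p∩q⊆p _ _)

    x∉φz : x ∉ φ ⁅ z ⁆
    x∉φz x∈φz = w∉φX (EGenerator-closure-least EB (⊆φ⇒φ⊆φ (x∈p⇒⁅x⁆⊆p z∈φX) x∈φz)
      (⊆Avoiding⇒∉φb (p∩q⊆q _ _ ∘ X⊆Q)) (φQ⊆φB ∘ φX⊆φQ) (φQ⊆φB w∈φQ))

  pseudoClosed-avoiding : EGenerator cs x B →
                          ∃[ P ] (PseudoClosed cs P × P ⊆ Avoiding x × φ P ≡ φ B)
  pseudoClosed-avoiding EB@((x∈φB , x∉φbB , _) , _)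
    with P , pseudoP , P⊆Q , φP≡φQ ←
           pseudoClosed-below (quasiClosed-∩Avoiding EB) (¬closed-∩Avoiding x∈φB x∉φbB) =
    P , pseudoP , p∩q⊆q _ _ ∘ P⊆Q , trans φP≡φQ (φ-∩Avoiding x∉φbB)

  EGenerator-inside : ∀ {P} → EGenerator cs x B → QuasiClosed cs P → P ⊆ Avoiding x →
                      φ P ≡ φ B → ∃[ A ] (EGenerator cs x A × A ⊆ P × φ A ≡ φ B)
  EGenerator-inside {x} {B} {P} EB@((x∈φB , _) , _) qP P⊆Avoiding φP≡φB =
    inside (DGenerator-below x∈φP (⊆Avoiding⇒∉φb P⊆Avoiding))
    where
    x∈φP : x ∈ φ P
    x∈φP = subst (x ∈_) (sym φP≡φB) x∈φB

    inside : ∃[ A ] (DGenerator cs x A × φb cs A ⊆ φb cs P) →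
             ∃[ A ] (EGenerator cs x A × A ⊆ P × φ A ≡ φ B)
    inside (A , DA , φbA⊆φbP) =
      let EA , φA≡φB = EGenerator-sameClosure EB DA (subst (φ A ⊆_) φP≡φB (φb⊆φb⇒φ⊆φ φbA⊆φbP))
      in  A , EA , φb⊆-quasiClosed qP x∈φP P⊆Avoiding ∘ φbA⊆φbP ∘ ⊆-φb , φA≡φB

theorem9 : ∀ {n : ℕ} (cs : ClosureOperator n) → Standard cs → (x : Fin n) →
    ∀ (C : Subset n) → (∃[ B ] (EGenerator cs x B × ClosureOperator.φ cs B ≡ C)) →
    ∃[ P ] ∃[ A ] (PseudoClosed cs P × EGenerator cs x A × A ⊆ P × x ∉ P ×
      ClosureOperator.φ cs A ≡ C × ClosureOperator.φ cs P ≡ C)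
theorem9 cs _ x _ (B , EB , refl) with pseudoClosed-avoiding cs EB
... | P , pseudoP@(_ , qP , _) , P⊆Avoiding , φP≡φB
  with EGenerator-inside cs EB qP P⊆Avoiding φP≡φB
... | A , EA , A⊆P , φA≡φB =
  P , A , pseudoP , EA , A⊆P , x∉Avoiding cs ∘ P⊆Avoiding , φA≡φB , φP≡φB
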